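{- Let $n\ge 1$ and $A\subseteq V(T_n)$. Then for $i=1,2$, \[ |N(A)|\ge |N(C_i^{ - }(A))|\quad\text{and}\quad |N(A)|\ge |N(C_i^{+}(A))| . \]
   Context: The triangular grid graph $T_n$ has vertex set $\{(v_1,v_2)\in\mathbb{Z}_{\ge 0}^2 : v_1+v_2\le n\}$, and two vertices are adjacent iff they are of the form $(a,b),(a+1,b)$, or $(a,b),(a,b+1)$, or $(a+1,b),(a,b+1)$. For $S\subseteq V(T_n)$, $\partial_{T_n}(S)$ is the set of vertices not in $S$ adjacent to some vertex of $S$, and $N(S)=S\cup\partial_{T_n}(S)$. For $A\subseteq V(T_n)$ and $0\le t\le n$, the $1$-sections are $A_{1,t}=\{v_2:(v_1,v_2)\in A,\ v_1=t\}$ and the $2$-sections are $A_{2,t}=\{v_1:(v_1,v_2)\in A,\ v_2=t\}$. The compressions are defined by their sections: $C_1^{ - }(A)=\{(t,s): 0\le t\le n,\ 0\le s\le |A_{1,t}|-1\}$, $C_2^{ - }(A)=\{(s,t): 0\le t\le n,\ 0\le s\le |A_{2,t}|-1\}$, $C_1^{+}(A)=\{(t,s): 0\le t\le n,\ n+1-t-|A_{1,t}|\le s\le n-t\}$, $C_2^{+}(A)=\{(s,t): 0\le t\le n,\ n+1-t-|A_{2,t}|\le s\le n-t\}$. (So $C_1^{ - }$ pushes the vertices of each column $v_1=t$ down, $C_2^{ - }$ pushes the vertices of each row $v_2=t$ to the left, and $C_1^{+},C_2^{+}$ push them up, respectively to the right, i.e. towards the diagonal $v_1+v_2=n$.) 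-}

module Defs where

open import Data.Nat using (ℕ; zero; suc; _+_; _∸_; _≤ᵇ_; _<ᵇ_; _≡ᵇ_)
open import Data.Bool using (Bool; true; false; _∧_; _∨_; not)
open import Data.Product using (_×_; _,_)
open import Data.List using (List; []; _∷_; _++_; map; filter; length; concatMap; upTo)
open import Data.Bool.ListAction using (any)
open import Relation.Nullary.Decidable using (does)
open import Relation.Binary.PropositionalEquality using (_≡_)
open import Data.Bool using (T?)

-- A vertex of the plane lattice; V(T_n) = {(a,b) : a + b ≤ n}.
Vertex : Set
Vertex = ℕ × ℕ

-- Subsets of V(T_n) are given by Boolean characteristic functions on ℕ × ℕ;
-- the subset represented is {v ∈ V(T_n) : A v = true} (values outside T_n are ignored).
SubsetT : Set
SubsetT = Vertex → Bool

inT : ℕ → Vertex → Bool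
inT n (a , b) = (a + b) ≤ᵇ n

vertices : ℕ → List Vertex
vertices n = concatMap (λ a → map (λ b → (a , b)) (upTo (suc (n ∸ a)))) (upTo (suc n))

mem : ℕ → SubsetT → Vertex → Bool
mem n A v = inT n v ∧ A v

-- Adjacency in T_n: (a,b)~(a+1,b), (a,b)~(a,b+1), (a+1,b)~(a,b+1) (symmetric).
adjDir : Vertex → Vertex → Bool
adjDir (a , b) (c , d) =
  ((c ≡ᵇ suc a) ∧ (d ≡ᵇ b)) ∨ ((c ≡ᵇ a) ∧ (d ≡ᵇ suc b)) ∨ ((suc c ≡ᵇ a) ∧ (d ≡ᵇ suc b))

adj : Vertex → Vertex → Bool
adj u v = adjDir u v ∨ adjDir v u

N : ℕ → SubsetT → SubsetT
N n A v = mem n A v ∨ (inT n v ∧ any (λ u → mem n A u ∧ adj u v) (vertices n))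

card : ℕ → SubsetT → ℕ
card n A = length (filter (λ v → T? (mem n A v)) (vertices n))

sec1 : ℕ → SubsetT → ℕ → ℕ
sec1 n A t = length (filter (λ s → T? (mem n A (t , s))) (upTo (suc n)))

sec2 : ℕ → SubsetT → ℕ → ℕ
sec2 n A t = length (filter (λ s → T? (mem n A (s , t))) (upTo (suc n)))

C1⁻ : ℕ → SubsetT → SubsetT
C1⁻ n A (t , s) = (t ≤ᵇ n) ∧ (s <ᵇ sec1 n A t)

C2⁻ : ℕ → SubsetT → SubsetT
C2⁻ n A (s , t) = (t ≤ᵇ n) ∧ (s <ᵇ sec2 n A t)

C1⁺ : ℕ → SubsetT → SubsetT
C1⁺ n A (t , s) = (t ≤ᵇ n) ∧ (((suc n ∸ t) ∸ sec1 n A t) ≤ᵇ s) ∧ (s ≤ᵇ (n ∸ t))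

C2⁺ : ℕ → SubsetT → SubsetT
C2⁺ n A (s , t) = (t ≤ᵇ n) ∧ (((suc n ∸ t) ∸ sec2 n A t) ≤ᵇ s) ∧ (s ≤ᵇ (n ∸ t))

{-# OPTIONS --safe #-}
module Submission where

-- The compression C1⁻ acts column by column, so N (C1⁻ A) and N A can be compared column by
-- column.  If column t of A has c_t vertices, then column t of N (C1⁻ A) is an initial segment of
-- length at most max (c_t + 1, c_{t-1}, c_{t+1} + 1) (reading c + 1 as 0 for c = 0), cut off at the
-- n - t + 1 vertices of that column.  Conversely each of the columns t - 1, t, t + 1 of A alone
-- forces that many vertices of N A into column t: a subset of a path that is neither empty nor
-- everything has an outside vertex adjacent to it, so its closed neighbourhood is strictly larger,
-- and the horizontal and diagonal edges carry column t ± 1 to column t by s ↦ s and s ↦ s ± 1.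
-- Summing over columns gives |N (C1⁻ A)| ≤ |N A|.  The column reflection (t , s) ↦ (t , n - t - s)
-- and the transposition (a , b) ↦ (b , a) are automorphisms of T_n, hence preserve |N|; the first
-- conjugates C1⁺ into C1⁻ and the second exchanges 1- and 2-sections, giving the other three cases.

open import Defs
open import Algebra.Properties.CommutativeSemigroup using (interchange)
open import Data.Bool using (Bool; true; false; _∧_; _∨_; not; T; T?; if_then_else_)
open import Data.Bool.Properties using (T-≡; not-injective; ∧-conicalˡ; ∧-conicalʳ; ∧-identityʳ; ∨-zeroʳ)
open import Data.Bool.ListAction using (any; or)
open import Data.List using (List; []; _∷_; _++_; map; filter; length; concatMap; upTo; applyUpTo)
open import Data.List.Membership.Propositional using (_∈_; lose)
open import Data.List.Membership.Propositional.Properties using (∈-map⁺; ∈-upTo⁺; ∈-concatMap⁺)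
open import Data.List.Properties using (map-cong)
open import Data.List.Relation.Unary.Any using (satisfied)
open import Data.List.Relation.Unary.Any.Properties using (any⁺; any⁻)
open import Data.Nat using (ℕ; zero; suc; _+_; _∸_; _≤_; _<_; _≥_; _⊓_; _⊔_; _≤ᵇ_; _<ᵇ_; _≡ᵇ_; z≤n; s≤s; s≤s⁻¹; z<s; s<s)
open import Data.Nat.Properties
open import Data.Product using (_×_; _,_; ∃)
open import Data.Sum using (_⊎_; inj₁; inj₂; [_,_]′)
open import Function using (_∘_; id; Equivalence)
open import Relation.Binary.Definitions using (tri<; tri≈; tri>)
open import Relation.Binary.PropositionalEquality
open import Relation.Nullary using (contradiction)

from-T : ∀ {b} → T b → b ≡ true
from-T = Equivalence.to T-≡

to-T : ∀ {b} → b ≡ true → T b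
to-T = Equivalence.from T-≡

≤ᵇ-true⇒≤ : ∀ {m n} → (m ≤ᵇ n) ≡ true → m ≤ n
≤ᵇ-true⇒≤ = ≤ᵇ⇒≤ _ _ ∘ to-T

≤⇒≤ᵇ-true : ∀ {m n} → m ≤ n → (m ≤ᵇ n) ≡ true
≤⇒≤ᵇ-true = from-T ∘ ≤⇒≤ᵇ

<ᵇ-true⇒< : ∀ {m n} → (m <ᵇ n) ≡ true → m < n
<ᵇ-true⇒< = <ᵇ⇒< _ _ ∘ to-T

<⇒<ᵇ-true : ∀ {m n} → m < n → (m <ᵇ n) ≡ true
<⇒<ᵇ-true = from-T ∘ <⇒<ᵇ

≡ᵇ-true⇒≡ : ∀ {m n} → (m ≡ᵇ n) ≡ true → m ≡ n
≡ᵇ-true⇒≡ = ≡ᵇ⇒≡ _ _ ∘ to-T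

≡ᵇ-refl : ∀ n → (n ≡ᵇ n) ≡ true
≡ᵇ-refl n = from-T (≡⇒≡ᵇ n n refl)

true-false⇒≢ : ∀ {f : ℕ → Bool} {a b} → f a ≡ true → f b ≡ false → a ≢ b
true-false⇒≢ fa fb refl with trans (sym fa) fb
... | ()

∨-true : ∀ a {b} → a ∨ b ≡ true → a ≡ true ⊎ b ≡ true
∨-true true  _ = inj₁ refl
∨-true false e = inj₂ e

∨-introʳ : ∀ a {b} → b ≡ true → a ∨ b ≡ true
∨-introʳ a refl = ∨-zeroʳ a

true-ext : ∀ {a b} → (a ≡ true → b ≡ true) → (b ≡ true → a ≡ true) → a ≡ b
true-ext {true}  a⇒b _   = sym (a⇒b refl)
true-ext {false} {true}  _ b⇒a = b⇒a refl
true-ext {false} {false} _ _   = refl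

any-witness : ∀ {X : Set} (p : X → Bool) xs → any p xs ≡ true → ∃ λ x → p x ≡ true
any-witness p xs e with satisfied (any⁻ p xs (to-T e))
... | x , px = x , from-T px

any-intro : ∀ {X : Set} (p : X → Bool) {x xs} → x ∈ xs → p x ≡ true → any p xs ≡ true
any-intro p x∈xs px = from-T (any⁺ p (lose x∈xs (to-T px)))

sumUpTo : (ℕ → ℕ) → ℕ → ℕ
sumUpTo g zero    = 0
sumUpTo g (suc k) = g 0 + sumUpTo (g ∘ suc) k

count : (ℕ → Bool) → ℕ → ℕ
count p = sumUpTo (λ i → if p i then 1 else 0)

sumUpTo-snoc : ∀ g k → sumUpTo g (suc k) ≡ sumUpTo g k + g k
sumUpTo-snoc g zero    = +-comm (g 0) 0
sumUpTo-snoc g (suc k) = trans (cong (g 0 +_) (sumUpTo-snoc (g ∘ suc) k)) (sym (+-assoc (g 0) _ _))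

sumUpTo-cong : ∀ {g h} k → (∀ i → i < k → g i ≡ h i) → sumUpTo g k ≡ sumUpTo h k
sumUpTo-cong zero    eq = refl
sumUpTo-cong (suc k) eq = cong₂ _+_ (eq 0 z<s) (sumUpTo-cong k (λ i i<k → eq (suc i) (s<s i<k)))

sumUpTo-mono-≤ : ∀ {g h} k → (∀ i → i < k → g i ≤ h i) → sumUpTo g k ≤ sumUpTo h k
sumUpTo-mono-≤ zero    le = z≤n
sumUpTo-mono-≤ (suc k) le = +-mono-≤ (le 0 z<s) (sumUpTo-mono-≤ k (λ i i<k → le (suc i) (s<s i<k)))

sumUpTo-zero : ∀ k → sumUpTo (λ _ → 0) k ≡ 0
sumUpTo-zero zero    = refl
sumUpTo-zero (suc k) = sumUpTo-zero k

sumUpTo-distrib-+ : ∀ g h k → sumUpTo (λ i → g i + h i) k ≡ sumUpTo g k + sumUpTo h k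
sumUpTo-distrib-+ g h zero    = refl
sumUpTo-distrib-+ g h (suc k) =
  trans (cong (g 0 + h 0 +_) (sumUpTo-distrib-+ (g ∘ suc) (h ∘ suc) k))
    (interchange +-commutativeSemigroup (g 0) (h 0) _ _)

sumUpTo-comm : ∀ (g : ℕ → ℕ → ℕ) k m →
  sumUpTo (λ a → sumUpTo (g a) m) k ≡ sumUpTo (λ b → sumUpTo (λ a → g a b) k) m
sumUpTo-comm g zero    m = sym (sumUpTo-zero m)
sumUpTo-comm g (suc k) m = trans (cong (sumUpTo (g 0) m +_) (sumUpTo-comm (g ∘ suc) k m))
  (sym (sumUpTo-distrib-+ (g 0) (λ b → sumUpTo (λ a → g (suc a) b) k) m))

sumUpTo-reverse : ∀ g L → sumUpTo (λ i → g (L ∸ i)) (suc L) ≡ sumUpTo g (suc L)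
sumUpTo-reverse g zero    = refl
sumUpTo-reverse g (suc L) = begin
  g (suc L) + sumUpTo (λ i → g (L ∸ i)) (suc L) ≡⟨ cong (g (suc L) +_) (sumUpTo-reverse g L) ⟩
  g (suc L) + sumUpTo g (suc L)                  ≡⟨ +-comm (g (suc L)) _ ⟩
  sumUpTo g (suc L) + g (suc L)                  ≡⟨ sym (sumUpTo-snoc g (suc L)) ⟩
  sumUpTo g (suc (suc L))                        ∎
  where open ≡-Reasoning

_⊆⟨_⟩_ : (ℕ → Bool) → ℕ → (ℕ → Bool) → Set
p ⊆⟨ k ⟩ q = ∀ s → s < k → p s ≡ true → q s ≡ true

⊆-tail : ∀ {p q k} → p ⊆⟨ suc k ⟩ q → (p ∘ suc) ⊆⟨ k ⟩ (q ∘ suc)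
⊆-tail p⊆q i i<k = p⊆q (suc i) (s<s i<k)

if-mono : ∀ {a b : Bool} → (a ≡ true → b ≡ true) → (if a then 1 else 0) ≤ (if b then 1 else 0)
if-mono {true}  a⇒b rewrite a⇒b refl = ≤-refl
if-mono {false} _ = z≤n

count-snoc : ∀ p k → count p (suc k) ≡ count p k + (if p k then 1 else 0)
count-snoc p = sumUpTo-snoc _

count-≤ : ∀ p k → count p k ≤ k
count-≤ p zero = z≤n
count-≤ p (suc k) with p 0
... | true  = s≤s (count-≤ (p ∘ suc) k)
... | false = m≤n⇒m≤1+n (count-≤ (p ∘ suc) k)

count-mono-⊆ : ∀ {p q} k → p ⊆⟨ k ⟩ q → count p k ≤ count q k
count-mono-⊆ k p⊆q = sumUpTo-mono-≤ k (λ i i<k → if-mono (p⊆q i i<k))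

count-<-⊂ : ∀ {p q} k {s} → s < k → p s ≡ false → q s ≡ true → p ⊆⟨ k ⟩ q → count p k < count q k
count-<-⊂ (suc k) {zero} _ ps qs p⊆q rewrite ps | qs = s≤s (count-mono-⊆ k (⊆-tail p⊆q))
count-<-⊂ {p} {q} (suc k) {suc s} s<k ps qs p⊆q =
  subst (_≤ count q (suc k)) (+-suc _ (count (p ∘ suc) k))
    (+-mono-≤ (if-mono (p⊆q 0 z<s)) (count-<-⊂ k (s≤s⁻¹ s<k) ps qs (⊆-tail p⊆q)))

count-all-false : ∀ p d → (∀ s → p s ≡ false) → count p d ≡ 0
count-all-false p zero    _  = refl
count-all-false p (suc d) pF rewrite pF 0 = count-all-false (p ∘ suc) d (pF ∘ suc)

count-+-false : ∀ p K d → (∀ s → K ≤ s → p s ≡ false) → count p (K + d) ≡ count p K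
count-+-false p zero    d pF = count-all-false p d (λ s → pF s z≤n)
count-+-false p (suc K) d pF =
  cong (_ +_) (count-+-false (p ∘ suc) K d (λ s K≤s → pF (suc s) (s≤s K≤s)))

count-≤-bound : ∀ p k B → (∀ s → s < k → p s ≡ true → s < B) → count p k ≤ B
count-≤-bound p zero    B _ = z≤n
count-≤-bound p (suc k) B below rewrite count-snoc p k with p k in pk
... | true  = ≤-trans (+-monoˡ-≤ 1 (count-≤ p k)) (subst (_≤ B) (+-comm 1 k) (below k ≤-refl pk))
... | false = subst (_≤ B) (sym (+-identityʳ _)) (count-≤-bound p k B (λ s s<k → below s (m<n⇒m<1+n s<k)))

count>0⇒true : ∀ p k → 0 < count p k → ∃ λ s → s < k × p s ≡ true
count>0⇒true p (suc k) pos with p 0 in p0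
... | true  = 0 , z<s , p0
... | false with count>0⇒true (p ∘ suc) k pos
...   | s , s<k , ps = suc s , s<s s<k , ps

count<⇒false : ∀ p k → count p k < k → ∃ λ s → s < k × p s ≡ false
count<⇒false p (suc k) notFull with p 0 in p0
... | false = 0 , z<s , p0
... | true with count<⇒false (p ∘ suc) k (s≤s⁻¹ notFull)
...   | s , s<k , ps = suc s , s<s s<k , ps

-- Neighbourhoods of subsets of a line

rising-edge : ∀ (f : ℕ → Bool) {b a} → b < a → f b ≡ false → f a ≡ true →
  ∃ λ s → s < a × f s ≡ false × f (suc s) ≡ true
rising-edge f {b} {suc a} b<1+a fb f1+a with f a in fa
... | false = a , ≤-refl , fa , f1+a
... | true with rising-edge f {b} {a} (≤∧≢⇒< (s≤s⁻¹ b<1+a) (≢-sym (true-false⇒≢ {f} fa fb))) fb fa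
...   | s , s<a , fs , f1+s = s , m<n⇒m<1+n s<a , fs , f1+s

falling-edge : ∀ (f : ℕ → Bool) {a b} → a < b → f a ≡ true → f b ≡ false →
  ∃ λ s → s < b × f s ≡ true × f (suc s) ≡ false
falling-edge f a<b fa fb with rising-edge (not ∘ f) a<b (cong not fa) (cong not fb)
... | s , s<b , fs , f1+s = s , s<b , not-injective fs , not-injective f1+s

shiftUp : (ℕ → Bool) → ℕ → Bool
shiftUp f zero    = false
shiftUp f (suc s) = f s

boundary-point : ∀ (f : ℕ → Bool) {K a b} → a < K → b < K → f a ≡ true → f b ≡ false →
  ∃ λ s → s < K × f s ≡ false × (f (suc s) ≡ true ⊎ shiftUp f s ≡ true)
boundary-point f {a = a} {b} a<K b<K fa fb with <-cmp a b
... | tri< a<b _ _ = let s , s<b , fs , f1+s = falling-edge f a<b fa fb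
                     in suc s , <-≤-trans (s<s s<b) b<K , f1+s , inj₂ fs
... | tri≈ _ a≡b _ = contradiction a≡b (true-false⇒≢ fa fb)
... | tri> _ _ b<a = let s , s<a , fs , f1+s = rising-edge f b<a fb fa
                     in s , <-trans s<a a<K , fs , inj₁ f1+s

-- The size of the closed neighbourhood of a nonempty initial segment [0, c) of ℕ, and 0 for c = 0.
suc⁺ : ℕ → ℕ
suc⁺ zero    = zero
suc⁺ (suc c) = suc (suc c)

<⇒<suc⁺ : ∀ {x k} → x < k → x < suc⁺ k
<⇒<suc⁺ {k = suc k} x<k = m<n⇒m<1+n x<k

<⇒suc<suc⁺ : ∀ {x k} → x < k → suc x < suc⁺ k
<⇒suc<suc⁺ {k = suc k} x<k = s<s x<k

count-dilation : ∀ f h K → f ⊆⟨ K ⟩ h → (f ∘ suc) ⊆⟨ K ⟩ h → shiftUp f ⊆⟨ K ⟩ h →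
  K ⊓ suc⁺ (count f K) ≤ count h K
count-dilation f h K f⊆h f∘suc⊆h shift⊆h with count f K in eq
... | zero = subst (_≤ count h K) (sym (⊓-zeroʳ K)) z≤n
... | suc c with m≤n⇒m<n∨m≡n (subst (_≤ K) eq (count-≤ f K))
...   | inj₂ full = ≤-trans (m⊓n≤m K _) (subst (_≤ count h K) (trans eq full) (count-mono-⊆ K f⊆h))
...   | inj₁ notFull
  with count>0⇒true f K (subst (0 <_) (sym eq) z<s) | count<⇒false f K (subst (_< K) (sym eq) notFull)
...     | a , a<K , fa | b , b<K , fb with boundary-point f a<K b<K fa fb
...       | s , s<K , fs , hs = ≤-trans (m⊓n≤n K _)
  (subst (_≤ count h K) (cong suc eq) (count-<-⊂ K s<K fs ([ f∘suc⊆h s s<K , shift⊆h s s<K ]′ hs) f⊆h))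

count-down-dilation : ∀ f h M → f ⊆⟨ M ⟩ h → (f ∘ suc) ⊆⟨ M ⟩ h → M ⊓ count f (suc M) ≤ count h M
count-down-dilation f h M f⊆h f∘suc⊆h rewrite count-snoc f M with f M in fM
... | false = ≤-trans (m⊓n≤n M _) (subst (_≤ count h M) (sym (+-identityʳ _)) (count-mono-⊆ M f⊆h))
... | true with m≤n⇒m<n∨m≡n (count-≤ f M)
...   | inj₂ full = ≤-trans (m⊓n≤m M _) (subst (_≤ count h M) full (count-mono-⊆ M f⊆h))
...   | inj₁ notFull with count<⇒false f M notFull
...     | b , b<M , fb with rising-edge f b<M fb fM
...       | s , s<M , fs , f1+s = ≤-trans (m⊓n≤n M _)
  (subst (_≤ count h M) (+-comm 1 _) (count-<-⊂ M s<M fs (f∘suc⊆h s s<M f1+s) f⊆h))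

count-up-dilation : ∀ f h M → f M ≡ false → f ⊆⟨ suc M ⟩ h → shiftUp f ⊆⟨ suc M ⟩ h →
  suc⁺ (count f (suc M)) ≤ count h (suc M)
count-up-dilation f h M fM f⊆h shift⊆h with count f (suc M) in eq
... | zero = z≤n
... | suc c with count>0⇒true f (suc M) (subst (0 <_) (sym eq) z<s)
...   | a , a<1+M , fa with falling-edge f (≤∧≢⇒< (s≤s⁻¹ a<1+M) (true-false⇒≢ {f} fa fM)) fa fM
...     | s , s<M , fs , f1+s = subst (_≤ count h (suc M)) (cong suc eq)
  (count-<-⊂ (suc M) (s<s s<M) f1+s (shift⊆h (suc s) (s<s s<M) fs) f⊆h)

size : {X : Set} → (X → Bool) → List X → ℕ
size q xs = length (filter (T? ∘ q) xs)

size-∷ : ∀ {X : Set} (q : X → Bool) x xs → size q (x ∷ xs) ≡ (if q x then 1 else 0) + size q xs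
size-∷ q x xs with q x
... | true  = refl
... | false = refl

size-++ : ∀ {X : Set} (q : X → Bool) xs ys → size q (xs ++ ys) ≡ size q xs + size q ys
size-++ q []       ys = refl
size-++ q (x ∷ xs) ys = begin
  size q (x ∷ xs ++ ys)                            ≡⟨ size-∷ q x (xs ++ ys) ⟩
  (if q x then 1 else 0) + size q (xs ++ ys)       ≡⟨ cong (_ +_) (size-++ q xs ys) ⟩
  (if q x then 1 else 0) + (size q xs + size q ys) ≡⟨ +-assoc (if q x then 1 else 0) (size q xs) _ ⟨
  (if q x then 1 else 0) + size q xs + size q ys   ≡⟨ cong (_+ size q ys) (size-∷ q x xs) ⟨
  size q (x ∷ xs) + size q ys                      ∎
  where open ≡-Reasoning

size-map : ∀ {X Y : Set} (q : Y → Bool) (G : X → Y) xs → size q (map G xs) ≡ size (q ∘ G) xs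
size-map q G []       = refl
size-map q G (x ∷ xs) =
  trans (size-∷ q (G x) (map G xs)) (trans (cong (_ +_) (size-map q G xs)) (sym (size-∷ (q ∘ G) x xs)))

size-applyUpTo : ∀ {X : Set} (q : X → Bool) (h : ℕ → X) k → size q (applyUpTo h k) ≡ count (q ∘ h) k
size-applyUpTo q h zero    = refl
size-applyUpTo q h (suc k) = trans (size-∷ q (h 0) _) (cong (_ +_) (size-applyUpTo q (h ∘ suc) k))

size-concatMap : ∀ {X Y : Set} (q : Y → Bool) (F : X → List Y) (h : ℕ → X) k →
  size q (concatMap F (applyUpTo h k)) ≡ sumUpTo (λ a → size q (F (h a))) k
size-concatMap q F h zero    = refl
size-concatMap q F h (suc k) =
  trans (size-++ q (F (h 0)) _) (cong (_ +_) (size-concatMap q F (h ∘ suc) k))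

size-cong : ∀ {X : Set} {q r : X → Bool} → (∀ x → q x ≡ r x) → ∀ xs → size q xs ≡ size r xs
size-cong q≗r []       = refl
size-cong {q = q} {r} q≗r (x ∷ xs) = begin
  size q (x ∷ xs)                        ≡⟨ size-∷ q x xs ⟩
  (if q x then 1 else 0) + size q xs     ≡⟨ cong₂ (λ b m → (if b then 1 else 0) + m) (q≗r x) (size-cong q≗r xs) ⟩
  (if r x then 1 else 0) + size r xs     ≡⟨ size-∷ r x xs ⟨
  size r (x ∷ xs)                        ∎
  where open ≡-Reasoning

inT-column : ∀ {n t s} → t ≤ n → s < suc (n ∸ t) → inT n (t , s) ≡ true
inT-column {n} {t} {s} t≤n s≤n∸t =
  ≤⇒≤ᵇ-true {t + s} {n} (subst (_≤ n) (+-comm s t) (m≤o∸n⇒m+n≤o s t≤n (s≤s⁻¹ s≤n∸t)))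

inT⇒≤∸ : ∀ {n} a b → inT n (a , b) ≡ true → b ≤ n ∸ a
inT⇒≤∸ {n} a b v∈T = m+n≤o⇒m≤o∸n b (subst (_≤ n) (+-comm a b) (≤ᵇ-true⇒≤ v∈T))

above-column : ∀ {n t s} → n ∸ t < s → n < t + s
above-column {n} {t} n∸t<s = ≤-<-trans (m≤n+m∸n n t) (+-monoʳ-< t n∸t<s)

mem-outside : ∀ {n a b} S → n < a + b → mem n S (a , b) ≡ false
mem-outside {n} {a} {b} S n<a+b with (a + b) ≤ᵇ n in a+b≤n
... | true  = contradiction (≤ᵇ-true⇒≤ a+b≤n) (<⇒≱ n<a+b)
... | false = refl

mem⇒∈ : ∀ {n} S v → mem n S v ≡ true → S v ≡ true
mem⇒∈ {n} S v = ∧-conicalʳ (inT n v) (S v)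

∈-vertices : ∀ {n a b} → a + b ≤ n → (a , b) ∈ vertices n
∈-vertices {n} {a} {b} a+b≤n = ∈-concatMap⁺ (λ a → map (a ,_) (upTo (suc (n ∸ a))))
  (lose (∈-upTo⁺ (s≤s (m+n≤o⇒m≤o a a+b≤n))) (∈-map⁺ (a ,_) (∈-upTo⁺ (s≤s (m+n≤o⇒m≤o∸n b b+a≤n)))))
  where b+a≤n = subst (_≤ n) (+-comm a b) a+b≤n

column : ℕ → SubsetT → ℕ → ℕ
column n S t = count (λ s → mem n S (t , s)) (suc (n ∸ t))

card-columns : ∀ n S → card n S ≡ sumUpTo (column n S) (suc n)
card-columns n S = trans (size-concatMap (mem n S) (λ a → map (a ,_) (upTo (suc (n ∸ a)))) id (suc n))
  (sumUpTo-cong (suc n) λ a _ →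
    trans (size-map (mem n S) (a ,_) (upTo (suc (n ∸ a)))) (size-applyUpTo (λ b → mem n S (a , b)) id (suc (n ∸ a))))

sec1-count : ∀ n A t → sec1 n A t ≡ count (λ s → mem n A (t , s)) (suc n)
sec1-count n A t = size-applyUpTo (λ s → mem n A (t , s)) id (suc n)

sec2-count : ∀ n A t → sec2 n A t ≡ count (λ s → mem n A (s , t)) (suc n)
sec2-count n A t = size-applyUpTo (λ s → mem n A (s , t)) id (suc n)

column-extend : ∀ n S t {K} → n ∸ t ≤ K → count (λ s → mem n S (t , s)) (suc K) ≡ column n S t
column-extend n S t {K} n∸t≤K = begin
  count p (suc K)                          ≡⟨ cong (count p ∘ suc) (m+[n∸m]≡n n∸t≤K) ⟨
  count p (suc (n ∸ t) + (K ∸ (n ∸ t)))    ≡⟨ count-+-false p (suc (n ∸ t)) _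
                                                (λ s n∸t<s → mem-outside S (above-column {n} n∸t<s)) ⟩
  column n S t                             ∎
  where
  open ≡-Reasoning
  p = λ s → mem n S (t , s)

sec1≡column : ∀ n A t → sec1 n A t ≡ column n A t
sec1≡column n A t = trans (sec1-count n A t) (column-extend n A t (m∸n≤m n t))

data Edge : Vertex → Vertex → Set where
  east      : ∀ a b → Edge (a , b) (suc a , b)
  north     : ∀ a b → Edge (a , b) (a , suc b)
  northwest : ∀ a b → Edge (suc a , b) (a , suc b)

Adjacent : Vertex → Vertex → Set
Adjacent u v = Edge u v ⊎ Edge v u

adjDir⇒Edge : ∀ u v → adjDir u v ≡ true → Edge u v
adjDir⇒Edge (a , b) (c , d) e with ∨-true _ e
... | inj₁ e₁ with ≡ᵇ-true⇒≡ {c} (∧-conicalˡ _ _ e₁) | ≡ᵇ-true⇒≡ {d} (∧-conicalʳ _ _ e₁)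
...   | refl | refl = east a b
adjDir⇒Edge (a , b) (c , d) e | inj₂ e₂ with ∨-true _ e₂
... | inj₁ e₁ with ≡ᵇ-true⇒≡ {c} (∧-conicalˡ _ _ e₁) | ≡ᵇ-true⇒≡ {d} (∧-conicalʳ _ _ e₁)
...   | refl | refl = north a b
adjDir⇒Edge (a , b) (c , d) e | inj₂ e₂ | inj₂ e₃
  with ≡ᵇ-true⇒≡ {suc c} {a} (∧-conicalˡ _ _ e₃) | ≡ᵇ-true⇒≡ {d} (∧-conicalʳ _ _ e₃)
... | refl | refl = northwest c b

Edge⇒adjDir : ∀ {u v} → Edge u v → adjDir u v ≡ true
Edge⇒adjDir (east a b)      rewrite ≡ᵇ-refl a | ≡ᵇ-refl b = refl
Edge⇒adjDir (north a b)     rewrite ≡ᵇ-refl a | ≡ᵇ-refl b = ∨-zeroʳ _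
Edge⇒adjDir (northwest a b) rewrite ≡ᵇ-refl a | ≡ᵇ-refl b =
  trans (cong ((a ≡ᵇ suc (suc a)) ∧ (suc b ≡ᵇ b) ∨_) (∨-zeroʳ _)) (∨-zeroʳ _)

adj⇒Adjacent : ∀ u v → adj u v ≡ true → Adjacent u v
adj⇒Adjacent u v e with ∨-true (adjDir u v) e
... | inj₁ uv = inj₁ (adjDir⇒Edge u v uv)
... | inj₂ vu = inj₂ (adjDir⇒Edge v u vu)

Adjacent⇒adj : ∀ {u v} → Adjacent u v → adj u v ≡ true
Adjacent⇒adj (inj₁ uv) rewrite Edge⇒adjDir uv = refl
Adjacent⇒adj {u} {v} (inj₂ vu) = ∨-introʳ (adjDir u v) (Edge⇒adjDir vu)

mem⇒N : ∀ n A {v} → mem n A v ≡ true → N n A v ≡ true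
mem⇒N n A e rewrite e = refl

Adjacent⇒N : ∀ n A {u v} → inT n v ≡ true → mem n A u ≡ true → Adjacent u v → N n A v ≡ true
Adjacent⇒N n A {a , b} {v} v∈T u∈A u~v = ∨-introʳ (mem n A v) (cong₂ _∧_ v∈T
  (any-intro (λ w → mem n A w ∧ adj w v) (∈-vertices (≤ᵇ-true⇒≤ {a + b} {n} (∧-conicalˡ _ _ u∈A)))
    (cong₂ _∧_ u∈A (Adjacent⇒adj u~v))))

N⇒ : ∀ n A v → N n A v ≡ true → mem n A v ≡ true ⊎ ∃ λ u → mem n A u ≡ true × Adjacent u v
N⇒ n A v e with ∨-true (mem n A v) e
... | inj₁ v∈A = inj₁ v∈A
... | inj₂ e₂ with any-witness _ (vertices n) (∧-conicalʳ _ _ e₂)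
...   | u , e₃ = inj₂ (u , ∧-conicalˡ _ _ e₃ , adj⇒Adjacent u v (∧-conicalʳ _ _ e₃))

Agree : ℕ → SubsetT → SubsetT → Set
Agree n S₁ S₂ = ∀ v → inT n v ≡ true → S₁ v ≡ S₂ v

module _ {n : ℕ} {S₁ S₂ : SubsetT} (S₁≈S₂ : Agree n S₁ S₂) where

  mem-cong : ∀ v → mem n S₁ v ≡ mem n S₂ v
  mem-cong v with inT n v in v∈T
  ... | true  = S₁≈S₂ v v∈T
  ... | false = refl

  card-cong : card n S₁ ≡ card n S₂
  card-cong = size-cong mem-cong (vertices n)

  N-cong : ∀ v → N n S₁ v ≡ N n S₂ v
  N-cong v = cong₂ _∨_ (mem-cong v)
    (cong (inT n v ∧_) (cong or (map-cong (λ u → cong (_∧ adj u v) (mem-cong u)) (vertices n))))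

  card-N-cong : card n (N n S₁) ≡ card n (N n S₂)
  card-N-cong = size-cong (λ v → cong (inT n v ∧_) (N-cong v)) (vertices n)

-- Automorphisms of T_n

record Symmetry (n : ℕ) (φ : Vertex → Vertex) : Set where
  field
    maps-T     : ∀ {v} → inT n v ≡ true → inT n (φ v) ≡ true
    involutive : ∀ {v} → inT n v ≡ true → φ (φ v) ≡ v
    maps-Edge  : ∀ {u v} → inT n u ≡ true → inT n v ≡ true → Edge u v → Adjacent (φ u) (φ v)
    card-∘     : ∀ S → card n (S ∘ φ) ≡ card n S

  maps-Adjacent : ∀ {u v} → inT n u ≡ true → inT n v ≡ true → Adjacent u v → Adjacent (φ u) (φ v)
  maps-Adjacent u∈T v∈T (inj₁ uv) = maps-Edge u∈T v∈T uv
  maps-Adjacent u∈T v∈T (inj₂ vu) with maps-Edge v∈T u∈T vu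
  ... | inj₁ φvφu = inj₂ φvφu
  ... | inj₂ φuφv = inj₁ φuφv

  N-∘ : ∀ B {v} → inT n v ≡ true → N n (B ∘ φ) v ≡ N n B (φ v)
  N-∘ B {v} v∈T = true-ext forward backward
    where
    forward : N n (B ∘ φ) v ≡ true → N n B (φ v) ≡ true
    forward e with N⇒ n (B ∘ φ) v e
    ... | inj₁ v∈Bφ = mem⇒N n B (cong₂ _∧_ (maps-T v∈T) (∧-conicalʳ _ _ v∈Bφ))
    ... | inj₂ (u , u∈Bφ , u~v) = Adjacent⇒N n B (maps-T v∈T)
      (cong₂ _∧_ (maps-T u∈T) (∧-conicalʳ _ _ u∈Bφ)) (maps-Adjacent u∈T v∈T u~v)
      where u∈T = ∧-conicalˡ _ _ u∈Bφ

    backward : N n B (φ v) ≡ true → N n (B ∘ φ) v ≡ true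
    backward e with N⇒ n B (φ v) e
    ... | inj₁ φv∈B = mem⇒N n (B ∘ φ) (cong₂ _∧_ v∈T (∧-conicalʳ _ _ φv∈B))
    ... | inj₂ (u , u∈B , u~φv) = Adjacent⇒N n (B ∘ φ) v∈T
      (cong₂ _∧_ (maps-T u∈T) (trans (cong B (involutive u∈T)) (∧-conicalʳ _ _ u∈B)))
      (subst (Adjacent (φ u)) (involutive v∈T) (maps-Adjacent u∈T (maps-T v∈T) u~φv))
      where u∈T = ∧-conicalˡ _ _ u∈B

  card-N-∘ : ∀ B → card n (N n (B ∘ φ)) ≡ card n (N n B)
  card-N-∘ B = trans (card-cong {S₂ = N n B ∘ φ} (λ v v∈T → N-∘ B v∈T)) (card-∘ (N n B))

transpose : Vertex → Vertex
transpose (a , b) = (b , a)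

inT-transpose : ∀ n a b → inT n (a , b) ≡ inT n (b , a)
inT-transpose n a b = cong (_≤ᵇ n) (+-comm a b)

card-sec1 : ∀ n S → card n S ≡ sumUpTo (sec1 n S) (suc n)
card-sec1 n S = trans (card-columns n S)
  (sumUpTo-cong (suc n) λ a _ → sym (sec1≡column n S a))

sec1-transpose : ∀ n A t → sec1 n (A ∘ transpose) t ≡ sec2 n A t
sec1-transpose n A t = begin
  sec1 n (A ∘ transpose) t                         ≡⟨ sec1-count n (A ∘ transpose) t ⟩
  count (λ s → inT n (t , s) ∧ A (s , t)) (suc n)  ≡⟨ sumUpTo-cong (suc n) (λ s _ →
                                                        cong (λ b → if b ∧ A (s , t) then 1 else 0) (inT-transpose n t s)) ⟩
  count (λ s → mem n A (s , t)) (suc n)            ≡⟨ sec2-count n A t ⟨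
  sec2 n A t                                       ∎
  where open ≡-Reasoning

card-∘-transpose : ∀ n S → card n (S ∘ transpose) ≡ card n S
card-∘-transpose n S = begin
  card n (S ∘ transpose)                                          ≡⟨ card-sec1 n (S ∘ transpose) ⟩
  sumUpTo (sec1 n (S ∘ transpose)) (suc n)                        ≡⟨ sumUpTo-cong (suc n) (λ a _ →
                                                                       trans (sec1-transpose n S a) (sec2-count n S a)) ⟩
  sumUpTo (λ a → count (λ b → mem n S (b , a)) (suc n)) (suc n)   ≡⟨ sumUpTo-comm (λ a b → if mem n S (b , a) then 1 else 0)
                                                                       (suc n) (suc n) ⟩
  sumUpTo (λ b → count (λ a → mem n S (b , a)) (suc n)) (suc n)   ≡⟨ sumUpTo-cong (suc n) (λ b _ → sec1-count n S b) ⟨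
  sumUpTo (sec1 n S) (suc n)                                      ≡⟨ card-sec1 n S ⟨
  card n S                                                        ∎
  where open ≡-Reasoning

transpose-symmetry : ∀ n → Symmetry n transpose
transpose-symmetry n = record
  { maps-T     = λ {(a , b)} a+b≤n → trans (inT-transpose n b a) a+b≤n
  ; involutive = λ _ → refl
  ; maps-Edge  = λ { _ _ (east a b) → inj₁ (north b a)
                   ; _ _ (north a b) → inj₁ (east b a)
                   ; _ _ (northwest a b) → inj₂ (northwest b a) }
  ; card-∘     = card-∘-transpose n
  }

reflect : ℕ → Vertex → Vertex
reflect n (a , b) = (a , n ∸ a ∸ b)

n∸1+a∸b≡n∸a∸1+b : ∀ n a b → n ∸ suc a ∸ b ≡ n ∸ a ∸ suc b
n∸1+a∸b≡n∸a∸1+b n a b = begin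
  n ∸ suc a ∸ b    ≡⟨ ∸-+-assoc n (suc a) b ⟩
  n ∸ suc (a + b)  ≡⟨ cong (n ∸_) (+-suc a b) ⟨
  n ∸ (a + suc b)  ≡⟨ ∸-+-assoc n a (suc b) ⟨
  n ∸ a ∸ suc b    ∎
  where open ≡-Reasoning

n∸a∸b≡1+n∸a∸1+b : ∀ n a b → a + suc b ≤ n → n ∸ a ∸ b ≡ suc (n ∸ a ∸ suc b)
n∸a∸b≡1+n∸a∸1+b n a b a+b<n = begin
  n ∸ a ∸ b              ≡⟨ ∸-+-assoc n a b ⟩
  n ∸ (a + b)            ≡⟨ +-∸-assoc 1 (subst (_≤ n) (+-suc a b) a+b<n) ⟩
  suc (n ∸ suc (a + b))  ≡⟨ cong (λ m → suc (n ∸ m)) (+-suc a b) ⟨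
  suc (n ∸ (a + suc b))  ≡⟨ cong suc (∸-+-assoc n a (suc b)) ⟨
  suc (n ∸ a ∸ suc b)    ∎
  where open ≡-Reasoning

reflect-Edge : ∀ n {u v} → inT n v ≡ true → Edge u v → Adjacent (reflect n u) (reflect n v)
reflect-Edge n v∈T (east a b) = subst (λ c → Adjacent (a , c) (suc a , n ∸ suc a ∸ b))
  (sym (trans (n∸a∸b≡1+n∸a∸1+b n a b (subst (_≤ n) (sym (+-suc a b)) (≤ᵇ-true⇒≤ v∈T)))
              (cong suc (sym (n∸1+a∸b≡n∸a∸1+b n a b)))))
  (inj₂ (northwest a _))
reflect-Edge n v∈T (north a b) = subst (λ c → Adjacent (a , c) (a , n ∸ a ∸ suc b))
  (sym (n∸a∸b≡1+n∸a∸1+b n a b (≤ᵇ-true⇒≤ v∈T))) (inj₂ (north a _))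
reflect-Edge n _ (northwest a b) = subst (λ c → Adjacent (suc a , n ∸ suc a ∸ b) (a , c))
  (n∸1+a∸b≡n∸a∸1+b n a b) (inj₂ (east a _))

column-∘-reflect : ∀ n S {t} → t ≤ n → column n (S ∘ reflect n) t ≡ column n S t
column-∘-reflect n S {t} t≤n = trans
  (sumUpTo-cong (suc (n ∸ t)) λ s s≤n∸t → cong (λ b → if b ∧ S (t , n ∸ t ∸ s) then 1 else 0)
    (trans (inT-column t≤n s≤n∸t) (sym (inT-column t≤n (s≤s (m∸n≤m (n ∸ t) s))))))
  (sumUpTo-reverse (λ s → if mem n S (t , s) then 1 else 0) (n ∸ t))

sec1-∘-reflect : ∀ n A {t} → t ≤ n → sec1 n (A ∘ reflect n) t ≡ sec1 n A t
sec1-∘-reflect n A {t} t≤n =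
  trans (sec1≡column n (A ∘ reflect n) t) (trans (column-∘-reflect n A t≤n) (sym (sec1≡column n A t)))

reflect-symmetry : ∀ n → Symmetry n (reflect n)
reflect-symmetry n = record
  { maps-T     = λ {(a , b)} v∈T → ≤⇒≤ᵇ-true {a + (n ∸ a ∸ b)} {n}
      (≤-trans (+-monoʳ-≤ a (m∸n≤m (n ∸ a) b)) (≤-reflexive (m+[n∸m]≡n (m+n≤o⇒m≤o a (≤ᵇ-true⇒≤ v∈T)))))
  ; involutive = λ {(a , b)} v∈T → cong (a ,_) (m∸[m∸n]≡n (inT⇒≤∸ a b v∈T))
  ; maps-Edge  = λ _ v∈T → reflect-Edge n v∈T
  ; card-∘     = λ S → trans (card-columns n (S ∘ reflect n))
      (trans (sumUpTo-cong (suc n) (λ a a<1+n → column-∘-reflect n S (s≤s⁻¹ a<1+n))) (sym (card-columns n S)))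
  }

-- The column compression C1⁻

module ColumnCompression (n : ℕ) (A : SubsetT) where

  height : ℕ → ℕ
  height = sec1 n A

  heightBefore : ℕ → ℕ
  heightBefore zero    = 0
  heightBefore (suc t) = height t

  -- Column t of N (C1⁻ A) lies below reach t; the three terms come from columns t, t - 1, t + 1 of C1⁻ A.
  reach : ℕ → ℕ
  reach t = suc⁺ (height t) ⊔ heightBefore t ⊔ suc⁺ (height (suc t))

  reach-own : ∀ {t x} → x < suc⁺ (height t) → x < reach t
  reach-own {t} x< = <-≤-trans x< (≤-trans (m≤m⊔n _ (heightBefore t)) (m≤m⊔n _ _))

  reach-before : ∀ {t x} → x < heightBefore t → x < reach t
  reach-before {t} x< = <-≤-trans x< (≤-trans (m≤n⊔m (suc⁺ (height t)) _) (m≤m⊔n _ _))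

  reach-after : ∀ {t x} → x < suc⁺ (height (suc t)) → x < reach t
  reach-after x< = <-≤-trans x< (m≤n⊔m _ _)

  C1⁻-height : ∀ a b → C1⁻ n A (a , b) ≡ true → b < height a
  C1⁻-height a b e = <ᵇ-true⇒< {b} {height a} (∧-conicalʳ (a ≤ᵇ n) _ e)

  Adjacent-below-reach : ∀ {u t s} → C1⁻ n A u ≡ true → Adjacent u (t , s) → s < reach t
  Adjacent-below-reach e (inj₁ (east a b))      = reach-before (C1⁻-height a b e)
  Adjacent-below-reach e (inj₁ (north a b))     = reach-own (<⇒suc<suc⁺ (C1⁻-height a b e))
  Adjacent-below-reach e (inj₁ (northwest a b)) = reach-after (<⇒suc<suc⁺ (C1⁻-height (suc a) b e))
  Adjacent-below-reach e (inj₂ (east a b))      = reach-after (<⇒<suc⁺ (C1⁻-height (suc a) b e))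
  Adjacent-below-reach e (inj₂ (north a b))     = reach-own (<⇒<suc⁺ (<-trans (n<1+n b) (C1⁻-height a (suc b) e)))
  Adjacent-below-reach e (inj₂ (northwest a b)) = reach-before (<-trans (n<1+n b) (C1⁻-height a (suc b) e))

  N-C1⁻-below-reach : ∀ t s → N n (C1⁻ n A) (t , s) ≡ true → s < reach t
  N-C1⁻-below-reach t s e with N⇒ n (C1⁻ n A) (t , s) e
  ... | inj₁ v∈C = reach-own (<⇒<suc⁺ (C1⁻-height t s (mem⇒∈ (C1⁻ n A) (t , s) v∈C)))
  ... | inj₂ (u , u∈C , u~v) = Adjacent-below-reach (mem⇒∈ (C1⁻ n A) u u∈C) u~v

  column-N-C1⁻-≤ : ∀ t → column n (N n (C1⁻ n A)) t ≤ suc (n ∸ t) ⊓ reach t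
  column-N-C1⁻-≤ t = ⊓-glb (count-≤ column-of-N (suc (n ∸ t)))
    (count-≤-bound column-of-N (suc (n ∸ t)) (reach t)
      (λ s _ e → N-C1⁻-below-reach t s (mem⇒∈ (N n (C1⁻ n A)) (t , s) e)))
    where column-of-N = λ s → mem n (N n (C1⁻ n A)) (t , s)

  inA : ℕ → ℕ → Bool
  inA t s = mem n A (t , s)

  inNA : ℕ → ℕ → Bool
  inNA t s = mem n (N n A) (t , s)

  Adjacent⇒inNA : ∀ {t s} u → t ≤ n → s < suc (n ∸ t) → mem n A u ≡ true → Adjacent u (t , s) →
    inNA t s ≡ true
  Adjacent⇒inNA u t≤n s≤n∸t u∈A u~v =
    cong₂ _∧_ (inT-column t≤n s≤n∸t) (Adjacent⇒N n A (inT-column t≤n s≤n∸t) u∈A u~v)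

  column-N-≥-own : ∀ {t} → t ≤ n → suc (n ∸ t) ⊓ suc⁺ (height t) ≤ column n (N n A) t
  column-N-≥-own {t} t≤n rewrite sec1≡column n A t =
    count-dilation (inA t) (inNA t) (suc (n ∸ t)) itself above below
    where
    itself : inA t ⊆⟨ suc (n ∸ t) ⟩ inNA t
    itself s s≤n∸t e = cong₂ _∧_ (inT-column t≤n s≤n∸t) (mem⇒N n A e)
    above : (inA t ∘ suc) ⊆⟨ suc (n ∸ t) ⟩ inNA t
    above s s≤n∸t e = Adjacent⇒inNA (t , suc s) t≤n s≤n∸t e (inj₂ (north t s))
    below : shiftUp (inA t) ⊆⟨ suc (n ∸ t) ⟩ inNA t
    below (suc s) s≤n∸t e = Adjacent⇒inNA (t , s) t≤n s≤n∸t e (inj₁ (north t s))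

  column-N-≥-before : ∀ {t} → t ≤ n → suc (n ∸ t) ⊓ heightBefore t ≤ column n (N n A) t
  column-N-≥-before {zero}  _   = subst (_≤ column n (N n A) 0) (sym (⊓-zeroʳ (suc n))) z≤n
  column-N-≥-before {suc t} t<n rewrite sec1≡column n A t | +-∸-assoc 1 t<n =
    count-down-dilation (inA t) (inNA (suc t)) (suc (n ∸ suc t)) east-of southeast-of
    where
    east-of : inA t ⊆⟨ suc (n ∸ suc t) ⟩ inNA (suc t)
    east-of s s≤n∸t e = Adjacent⇒inNA (t , s) t<n s≤n∸t e (inj₁ (east t s))
    southeast-of : (inA t ∘ suc) ⊆⟨ suc (n ∸ suc t) ⟩ inNA (suc t)
    southeast-of s s≤n∸t e = Adjacent⇒inNA (t , suc s) t<n s≤n∸t e (inj₂ (northwest t s))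

  column-N-≥-after : ∀ {t} → t ≤ n → suc (n ∸ t) ⊓ suc⁺ (height (suc t)) ≤ column n (N n A) t
  column-N-≥-after {t} t≤n = ≤-trans (m⊓n≤n _ _) (subst (λ c → suc⁺ c ≤ column n (N n A) t) (sym height≡)
    (count-up-dilation (inA (suc t)) (inNA t) (n ∸ t) beyond west-of northwest-of))
    where
    height≡ : height (suc t) ≡ count (inA (suc t)) (suc (n ∸ t))
    height≡ = trans (sec1≡column n A (suc t)) (sym (column-extend n A (suc t) (∸-monoʳ-≤ n (n≤1+n t))))
    beyond : inA (suc t) (n ∸ t) ≡ false
    beyond = mem-outside A (s≤s (≤-reflexive (sym (m+[n∸m]≡n t≤n))))
    west-of : inA (suc t) ⊆⟨ suc (n ∸ t) ⟩ inNA t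
    west-of s s≤n∸t e = Adjacent⇒inNA (suc t , s) t≤n s≤n∸t e (inj₂ (east t s))
    northwest-of : shiftUp (inA (suc t)) ⊆⟨ suc (n ∸ t) ⟩ inNA t
    northwest-of (suc s) s≤n∸t e = Adjacent⇒inNA (suc t , s) t≤n s≤n∸t e (inj₁ (northwest t s))

  column-N-≥ : ∀ {t} → t ≤ n → suc (n ∸ t) ⊓ reach t ≤ column n (N n A) t
  column-N-≥ {t} t≤n = begin
    L ⊓ (own ⊔ before ⊔ after)        ≡⟨ ⊓-distribˡ-⊔ L (own ⊔ before) after ⟩
    L ⊓ (own ⊔ before) ⊔ L ⊓ after    ≡⟨ cong (_⊔ L ⊓ after) (⊓-distribˡ-⊔ L own before) ⟩
    L ⊓ own ⊔ L ⊓ before ⊔ L ⊓ after  ≤⟨ ⊔-lub (⊔-lub (column-N-≥-own t≤n) (column-N-≥-before t≤n))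
                                                  (column-N-≥-after t≤n) ⟩
    column n (N n A) t                ∎
    where
    open ≤-Reasoning
    L = suc (n ∸ t)
    own = suc⁺ (height t)
    before = heightBefore t
    after = suc⁺ (height (suc t))

  card-N-C1⁻-≤ : card n (N n (C1⁻ n A)) ≤ card n (N n A)
  card-N-C1⁻-≤ = subst₂ _≤_ (sym (card-columns n (N n (C1⁻ n A)))) (sym (card-columns n (N n A)))
    (sumUpTo-mono-≤ (suc n) λ t t<1+n → ≤-trans (column-N-C1⁻-≤ t) (column-N-≥ (s≤s⁻¹ t<1+n)))

-- The remaining compressions by symmetry

Shrinks : ℕ → (SubsetT → SubsetT) → Set
Shrinks n K = ∀ A → card n (N n (K A)) ≤ card n (N n A)

shrinks-conjugate : ∀ {n φ} (K K′ : SubsetT → SubsetT) → Symmetry n φ →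
  (∀ A → Agree n (K A) (K′ (A ∘ φ) ∘ φ)) → Shrinks n K′ → Shrinks n K
shrinks-conjugate {n} {φ} K K′ φ-sym K≈K′ K′-shrinks A = begin
  card n (N n (K A))             ≡⟨ card-N-cong (K≈K′ A) ⟩
  card n (N n (K′ (A ∘ φ) ∘ φ))  ≡⟨ card-N-∘ (K′ (A ∘ φ)) ⟩
  card n (N n (K′ (A ∘ φ)))      ≤⟨ K′-shrinks (A ∘ φ) ⟩
  card n (N n (A ∘ φ))           ≡⟨ card-N-∘ A ⟩
  card n (N n A)                 ∎
  where
  open Symmetry φ-sym
  open ≤-Reasoning

[1+L∸c]≤ᵇs≡[L∸s]<ᵇc : ∀ L s c → s ≤ L → (suc L ∸ c ≤ᵇ s) ≡ (L ∸ s <ᵇ c)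
[1+L∸c]≤ᵇs≡[L∸s]<ᵇc L s c s≤L = true-ext to from
  where
  1+L∸[L∸s] : suc L ∸ (L ∸ s) ≡ suc s
  1+L∸[L∸s] = trans (+-∸-assoc 1 (m∸n≤m L s)) (cong suc (m∸[m∸n]≡n s≤L))
  to : (suc L ∸ c ≤ᵇ s) ≡ true → (L ∸ s <ᵇ c) ≡ true
  to e = <⇒<ᵇ-true {L ∸ s} {c} (≰⇒> λ c≤L∸s → 1+n≰n (begin
    suc s             ≡⟨ 1+L∸[L∸s] ⟨
    suc L ∸ (L ∸ s)   ≤⟨ ∸-monoʳ-≤ (suc L) c≤L∸s ⟩
    suc L ∸ c         ≤⟨ ≤ᵇ-true⇒≤ {suc L ∸ c} {s} e ⟩
    s                 ∎))
    where open ≤-Reasoning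
  from : (L ∸ s <ᵇ c) ≡ true → (suc L ∸ c ≤ᵇ s) ≡ true
  from e = ≤⇒≤ᵇ-true {suc L ∸ c} {s}
    (≤-trans (∸-monoʳ-≤ (suc L) (<ᵇ-true⇒< {L ∸ s} {c} e)) (≤-reflexive (m∸[m∸n]≡n s≤L)))

C1⁺-reflect : ∀ n A → Agree n (C1⁺ n A) (C1⁻ n (A ∘ reflect n) ∘ reflect n)
C1⁺-reflect n A (t , s) v∈T = cong ((t ≤ᵇ n) ∧_) (begin
  (suc n ∸ t ∸ sec1 n A t ≤ᵇ s) ∧ (s ≤ᵇ n ∸ t)  ≡⟨ cong ((suc n ∸ t ∸ sec1 n A t ≤ᵇ s) ∧_) (≤⇒≤ᵇ-true s≤n∸t) ⟩
  (suc n ∸ t ∸ sec1 n A t ≤ᵇ s) ∧ true         ≡⟨ ∧-identityʳ _ ⟩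
  (suc n ∸ t ∸ sec1 n A t ≤ᵇ s)                ≡⟨ cong (λ m → m ∸ sec1 n A t ≤ᵇ s) (+-∸-assoc 1 t≤n) ⟩
  (suc (n ∸ t) ∸ sec1 n A t ≤ᵇ s)              ≡⟨ [1+L∸c]≤ᵇs≡[L∸s]<ᵇc (n ∸ t) s (sec1 n A t) s≤n∸t ⟩
  (n ∸ t ∸ s <ᵇ sec1 n A t)                    ≡⟨ cong (n ∸ t ∸ s <ᵇ_) (sec1-∘-reflect n A t≤n) ⟨
  (n ∸ t ∸ s <ᵇ sec1 n (A ∘ reflect n) t)      ∎)
  where
  open ≡-Reasoning
  t≤n = m+n≤o⇒m≤o t (≤ᵇ-true⇒≤ {t + s} {n} v∈T)
  s≤n∸t = inT⇒≤∸ t s v∈T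

C2⁻-transpose : ∀ n A → Agree n (C2⁻ n A) (C1⁻ n (A ∘ transpose) ∘ transpose)
C2⁻-transpose n A (s , t) _ = cong (λ c → (t ≤ᵇ n) ∧ (s <ᵇ c)) (sym (sec1-transpose n A t))

C2⁺-transpose : ∀ n A → Agree n (C2⁺ n A) (C1⁺ n (A ∘ transpose) ∘ transpose)
C2⁺-transpose n A (s , t) _ =
  cong (λ c → (t ≤ᵇ n) ∧ ((suc n ∸ t ∸ c) ≤ᵇ s) ∧ (s ≤ᵇ n ∸ t)) (sym (sec1-transpose n A t))

C1⁻-shrinks : ∀ n → Shrinks n (C1⁻ n)
C1⁻-shrinks n A = ColumnCompression.card-N-C1⁻-≤ n A

C1⁺-shrinks : ∀ n → Shrinks n (C1⁺ n)
C1⁺-shrinks n = shrinks-conjugate (C1⁺ n) (C1⁻ n) (reflect-symmetry n) (C1⁺-reflect n) (C1⁻-shrinks n)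

-- The argument does not need n ≥ 1.
lemma1 : (n : ℕ) → 1 ≤ n → (A : SubsetT) →
    (card n (N n A) ≥ card n (N n (C1⁻ n A)) × card n (N n A) ≥ card n (N n (C1⁺ n A)))
    × (card n (N n A) ≥ card n (N n (C2⁻ n A)) × card n (N n A) ≥ card n (N n (C2⁺ n A)))
lemma1 n _ A =
    (C1⁻-shrinks n A , C1⁺-shrinks n A)
  , ( shrinks-conjugate (C2⁻ n) (C1⁻ n) (transpose-symmetry n) (C2⁻-transpose n) (C1⁻-shrinks n) A
    , shrinks-conjugate (C2⁺ n) (C1⁺ n) (transpose-symmetry n) (C2⁺-transpose n) (C1⁺-shrinks n) A)
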